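{- The flow rewriting system $\mathsf w$ is terminating: there is no infinite chain $A_1\to_{\mathsf w}A_2\to_{\mathsf w}\cdots$ of atomic flows.
   Context: An atomic flow is a finite directed acyclic graph whose vertices are labelled interaction (0 upper edges, 2 lower edges), cointeraction (2 upper, 0 lower), weakening (0 upper, 1 lower), coweakening (1 upper, 0 lower), contraction (2 upper, 1 lower) or cocontraction (1 upper, 2 lower); edges may also have a dangling upper end (upper edges of the flow) or dangling lower end (lower edges of the flow); and there is a polarity assignment of $\{+,-\}$ to edges with equal polarities on all edges of a (co)contraction and distinct polarities on the two edges of a (co)interaction. System $\mathsf w$ consists of seven local rules (each replaces a subgraph, keeping boundary edges): (1) a weakening whose lower edge is an upper edge of a contraction: delete both and that edge, merging the contraction's other upper edge with its lower edge; (2) a cocontraction one of whose lower edges is the upper edge of a coweakening: delete both and that edge, merging the cocontraction's upper edge with its other lower edge; (3) a weakening whose lower edge is an upper edge of a cointeraction: delete both and that edge, and the cointeraction's other upper edge becomes the upper edge of a new coweakening; (4) an interaction one of whose lower edges is the upper edge of a coweakening: delete both and that edge, and its other lower edge becomes the lower edge of a new weakening; (5) a weakening whose lower edge is the upper edge of a coweakening: delete both and the edge; (6) a weakening whose lower edge is the upper edge of a cocontraction: delete both and that edge, and each lower edge of the cocontraction becomes the lower edge of a new weakening; (7) a contraction whose lower edge is the upper edge of a coweakening: delete both and that edge, and each upper edge of the contraction becomes the upper edge of a new coweakening. $A\to_{\mathsf w}B$ means $B$ is obtained from $A$ by one application of one of these rules. -}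

module Defs where

open import Data.Nat using (ℕ; zero; suc; _+_)
open import Data.Fin using (Fin; zero; suc)
open import Data.Fin.Properties using () renaming (_≟_ to _≟ᶠ_)
open import Data.Bool using (Bool; true; false; if_then_else_; _∨_; not; T)
open import Data.Maybe using (Maybe; just; nothing)
import Data.Maybe as Maybe
open import Data.Maybe.Properties using (≡-dec)
open import Data.Sum using (_⊎_; inj₁; inj₂; [_,_]′)
open import Data.Product using (Σ; _,_; proj₁; proj₂; _×_)
open import Relation.Nullary using (¬_; does)
open import Relation.Binary.PropositionalEquality using (_≡_; _≢_)
open import Function.Bundles using (_↔_; Inverse)

data Kind : Set where
  interaction cointeraction weakening coweakening
    contraction cocontraction : Kind

upperArity : Kind → ℕ
upperArity interaction   = 0
upperArity cointeraction = 2
upperArity weakening     = 0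
upperArity coweakening   = 1
upperArity contraction   = 2
upperArity cocontraction = 1

lowerArity : Kind → ℕ
lowerArity interaction   = 2
lowerArity cointeraction = 0
lowerArity weakening     = 1
lowerArity coweakening   = 0
lowerArity contraction   = 1
lowerArity cocontraction = 2

data Polarity : Set where
  pos neg : Polarity

count : {n : ℕ} → (Fin n → Bool) → ℕ
count {zero}  P = 0
count {suc n} P = (if P zero then 1 else 0) + count (λ i → P (suc i))

isJust≡ : {n : ℕ} → Maybe (Fin n) → Fin n → Bool
isJust≡ m x = does (≡-dec _≟ᶠ_ m (just x))

-- Edges are directed downwards.
-- upEnd e   = the vertex at the upper end of e (nothing: dangling upper
--             end, i.e. e is an upper edge of the flow); e is then a
--             LOWER edge of that vertex.
-- downEnd e = the vertex at the lower end of e (nothing: dangling lower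
--             end); e is then an UPPER edge of that vertex.

data Path {nV nE : ℕ} (upEnd downEnd : Fin nE → Maybe (Fin nV))
    : Fin nV → Fin nV → Set where
  edge : ∀ {x y} e → upEnd e ≡ just x → downEnd e ≡ just y →
         Path upEnd downEnd x y
  _▸_  : ∀ {x y z} → Path upEnd downEnd x y → Path upEnd downEnd y z →
         Path upEnd downEnd x z

Incident : {nV nE : ℕ} (upEnd downEnd : Fin nE → Maybe (Fin nV)) →
  Fin nV → Fin nE → Set
Incident upEnd downEnd x e = (upEnd e ≡ just x) ⊎ (downEnd e ≡ just x)

record Flow : Set where
  field
    nV nE   : ℕ
    kind    : Fin nV → Kind
    upEnd   : Fin nE → Maybe (Fin nV)
    downEnd : Fin nE → Maybe (Fin nV)
    pol     : Fin nE → Polarity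

  field
    upper-arity : ∀ x → count (λ e → isJust≡ (downEnd e) x) ≡ upperArity (kind x)
    lower-arity : ∀ x → count (λ e → isJust≡ (upEnd e) x) ≡ lowerArity (kind x)
    acyclic : ∀ x → ¬ Path upEnd downEnd x x
    pol-contraction : ∀ x → kind x ≡ contraction →
      ∀ e e' → Incident upEnd downEnd x e → Incident upEnd downEnd x e' → pol e ≡ pol e'
    pol-cocontraction : ∀ x → kind x ≡ cocontraction →
      ∀ e e' → Incident upEnd downEnd x e → Incident upEnd downEnd x e' → pol e ≡ pol e'
    pol-interaction : ∀ x → kind x ≡ interaction →
      ∀ e e' → e ≢ e' → Incident upEnd downEnd x e → Incident upEnd downEnd x e' → pol e ≢ pol e'
    pol-cointeraction : ∀ x → kind x ≡ cointeraction →
      ∀ e e' → e ≢ e' → Incident upEnd downEnd x e → Incident upEnd downEnd x e' → pol e ≢ pol e'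

open Flow public

-- B is obtained from A by deleting the vertices with deadV, the edges
-- with deadE, adding k new vertices of kinds newKind, and re-attaching
-- the surviving edges as prescribed by upNew / downNew (ends in
-- Fin (nV A) refer to surviving old vertices, ends in Fin k to new ones).
-- B is identified with the result up to isomorphism (bijections σ, τ).

Alive : {n : ℕ} → (Fin n → Bool) → Set
Alive {n} dead = Σ (Fin n) (λ x → T (not (dead x)))

record Surgery (A B : Flow)
    (deadV : Fin (nV A) → Bool) (deadE : Fin (nE A) → Bool)
    (k : ℕ) (newKind : Fin k → Kind)
    (upNew downNew : Fin (nE A) → Maybe (Fin (nV A) ⊎ Fin k)) : Set where
  field
    σ : Fin (nV B) ↔ (Alive deadV ⊎ Fin k)
    τ : Fin (nE B) ↔ Alive deadE
  ρ : Fin (nV B) → Fin (nV A) ⊎ Fin k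
  ρ x = [ (λ y → inj₁ (proj₁ y)) , inj₂ ]′ (Inverse.to σ x)
  ε : Fin (nE B) → Fin (nE A)
  ε e = proj₁ (Inverse.to τ e)
  field
    kind-ok : ∀ x → kind B x ≡ [ kind A , newKind ]′ (ρ x)
    pol-ok  : ∀ e → pol B e ≡ pol A (ε e)
    up-ok   : ∀ e → Maybe.map ρ (upEnd B e) ≡ upNew (ε e)
    down-ok : ∀ e → Maybe.map ρ (downEnd B e) ≡ downNew (ε e)

_==_ : {n : ℕ} → Fin n → Fin n → Bool
x == y = does (x ≟ᶠ y)

old : {n k : ℕ} → Maybe (Fin n) → Maybe (Fin n ⊎ Fin k)
old = Maybe.map inj₁

no-new : Fin 0 → Kind
no-new ()

data _⟶w_ (A : Flow) (B : Flow) : Set where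

  -- (1) weakening w above contraction c (via edge a); b the other upper
  --     edge of c, d its lower edge; b and d are merged (b survives).
  rule1 : (w c : Fin (nV A)) (a b d : Fin (nE A)) →
    kind A w ≡ weakening → kind A c ≡ contraction →
    upEnd A a ≡ just w → downEnd A a ≡ just c →
    b ≢ a → downEnd A b ≡ just c → upEnd A d ≡ just c →
    Surgery A B (λ x → (x == w) ∨ (x == c)) (λ e → (e == a) ∨ (e == d))
      0 no-new
      (λ e → old (upEnd A e))
      (λ e → if e == b then old (downEnd A d) else old (downEnd A e)) →
    A ⟶w B

  -- (2) cocontraction cc above coweakening cw (via lower edge a of cc);
  --     b the other lower edge of cc, d its upper edge; merged (b survives).
  rule2 : (cc cw : Fin (nV A)) (a b d : Fin (nE A)) →
    kind A cc ≡ cocontraction → kind A cw ≡ coweakening →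
    upEnd A a ≡ just cc → downEnd A a ≡ just cw →
    b ≢ a → upEnd A b ≡ just cc → downEnd A d ≡ just cc →
    Surgery A B (λ x → (x == cc) ∨ (x == cw)) (λ e → (e == a) ∨ (e == d))
      0 no-new
      (λ e → if e == b then old (upEnd A d) else old (upEnd A e))
      (λ e → old (downEnd A e)) →
    A ⟶w B

  -- (3) weakening w above cointeraction ci (via a); the other upper edge
  --     b of ci gets a new coweakening.
  rule3 : (w ci : Fin (nV A)) (a b : Fin (nE A)) →
    kind A w ≡ weakening → kind A ci ≡ cointeraction →
    upEnd A a ≡ just w → downEnd A a ≡ just ci →
    b ≢ a → downEnd A b ≡ just ci →
    Surgery A B (λ x → (x == w) ∨ (x == ci)) (λ e → e == a)
      1 (λ _ → coweakening)
      (λ e → old (upEnd A e))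
      (λ e → if e == b then just (inj₂ zero) else old (downEnd A e)) →
    A ⟶w B

  -- (4) interaction i above coweakening cw (via a); the other lower edge
  --     b of i gets a new weakening.
  rule4 : (i cw : Fin (nV A)) (a b : Fin (nE A)) →
    kind A i ≡ interaction → kind A cw ≡ coweakening →
    upEnd A a ≡ just i → downEnd A a ≡ just cw →
    b ≢ a → upEnd A b ≡ just i →
    Surgery A B (λ x → (x == i) ∨ (x == cw)) (λ e → e == a)
      1 (λ _ → weakening)
      (λ e → if e == b then just (inj₂ zero) else old (upEnd A e))
      (λ e → old (downEnd A e)) →
    A ⟶w B

  rule5 : (w cw : Fin (nV A)) (a : Fin (nE A)) →
    kind A w ≡ weakening → kind A cw ≡ coweakening →
    upEnd A a ≡ just w → downEnd A a ≡ just cw →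
    Surgery A B (λ x → (x == w) ∨ (x == cw)) (λ e → e == a)
      0 no-new
      (λ e → old (upEnd A e))
      (λ e → old (downEnd A e)) →
    A ⟶w B

  -- (6) weakening w above cocontraction cc (via a); the lower edges
  --     b₁, b₂ of cc each get a new weakening.
  rule6 : (w cc : Fin (nV A)) (a b₁ b₂ : Fin (nE A)) →
    kind A w ≡ weakening → kind A cc ≡ cocontraction →
    upEnd A a ≡ just w → downEnd A a ≡ just cc →
    b₁ ≢ b₂ → upEnd A b₁ ≡ just cc → upEnd A b₂ ≡ just cc →
    Surgery A B (λ x → (x == w) ∨ (x == cc)) (λ e → e == a)
      2 (λ _ → weakening)
      (λ e → if e == b₁ then just (inj₂ zero)
             else if e == b₂ then just (inj₂ (suc zero))
             else old (upEnd A e))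
      (λ e → old (downEnd A e)) →
    A ⟶w B

  -- (7) contraction c above coweakening cw (via a); the upper edges
  --     b₁, b₂ of c each get a new coweakening.
  rule7 : (c cw : Fin (nV A)) (a b₁ b₂ : Fin (nE A)) →
    kind A c ≡ contraction → kind A cw ≡ coweakening →
    upEnd A a ≡ just c → downEnd A a ≡ just cw →
    b₁ ≢ b₂ → downEnd A b₁ ≡ just c → downEnd A b₂ ≡ just c →
    Surgery A B (λ x → (x == c) ∨ (x == cw)) (λ e → e == a)
      2 (λ _ → coweakening)
      (λ e → old (upEnd A e))
      (λ e → if e == b₁ then just (inj₂ zero)
             else if e == b₂ then just (inj₂ (suc zero))
             else old (downEnd A e)) →
    A ⟶w B

module Submission where

-- Every one of the seven rules of w deletes the edge a connecting its two
-- redex vertices and creates no new edge: the edges of the result are in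
-- bijection with the surviving edges of the source.  Hence the number of
-- edges strictly decreases along every rewrite step, so the converse of
-- ⟶w is well-founded (it is contained in the inverse image of < on ℕ
-- under the edge count).  A well-founded relation admits no infinite
-- descending sequence, and an infinite w-chain is exactly such a sequence.

open import Defs
open import Data.Nat using (ℕ; suc; _<_; s≤s)
open import Data.Nat.Induction using (<-wellFounded)
open import Data.Product using (Σ; _,_; _×_; proj₁)
open import Data.Sum using (inj₁)
open import Data.Fin using (Fin; punchOut; _≟_)
open import Data.Fin.Properties using (punchOut-injective; injective⇒≤)
open import Data.Bool using (Bool; T; not; _∨_)
open import Data.Bool.Properties using (T-irrelevant; T-≡; T-∨; T-not-≡)
open import Function.Base using (flip)
open import Function.Definitions using (Injective)
open import Function.Bundles using (_↣_; Injection; Equivalence)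
open import Function.Properties.Inverse using (↔⇒↣)
open import Induction.WellFounded using (WellFounded; module Subrelation)
open import Induction.InfiniteDescent
  using (InfiniteDescendingSequence; InfiniteDescendingSequenceFrom; descent∧wf⇒empty)
import Relation.Binary.Construct.On as On
open import Relation.Binary.Core using (Rel)
open import Level using (_⊔_)
open import Relation.Nullary using (¬_)
open import Relation.Nullary.Decidable using (dec-true)
open import Relation.Binary.PropositionalEquality
  using (_≡_; _≢_; refl; sym; trans; cong)

injective-avoiding⇒< : ∀ {m n} {f : Fin m → Fin n} → Injective _≡_ _≡_ f →
  (a : Fin n) → (∀ x → a ≢ f x) → m < n
injective-avoiding⇒< {n = suc _} f-inj a a∉f =
  s≤s (injective⇒≤ {f = λ x → punchOut (a∉f x)} punched-injective)
  where
  punched-injective : ∀ {x y} → punchOut (a∉f x) ≡ punchOut (a∉f y) → x ≡ y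
  punched-injective eq = f-inj (punchOut-injective (a∉f _) (a∉f _) eq)

-- An element of Alive dead is determined by its underlying point, since
-- the liveness witness T (not (dead x)) is a proposition.
alive-injective : ∀ {n} {dead : Fin n → Bool} {x y : Alive dead} →
  proj₁ x ≡ proj₁ y → x ≡ y
alive-injective {x = p , alive} {y = .p , alive′} refl =
  cong (p ,_) (T-irrelevant alive alive′)

dead≢alive : ∀ {n} {dead : Fin n → Bool} {a : Fin n} → T (dead a) →
  (x : Alive dead) → a ≢ proj₁ x
dead≢alive a-dead (_ , p-alive) refl
  with () ← trans (sym (Equivalence.to T-≡ a-dead)) (Equivalence.to T-not-≡ p-alive)

fewer-alive : ∀ {m n} {dead : Fin n → Bool} (a : Fin n) → T (dead a) →
  Fin m ↣ Alive dead → m < n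
fewer-alive a a-dead survivors =
  injective-avoiding⇒< to-point-injective a (λ x → dead≢alive a-dead (to x))
  where
  open Injection survivors using (to; injective)
  to-point-injective : ∀ {x y} → proj₁ (to x) ≡ proj₁ (to y) → x ≡ y
  to-point-injective eq = injective (alive-injective eq)

==-refl : ∀ {n} (a : Fin n) → T (a == a)
==-refl a = Equivalence.from T-≡ (dec-true (a ≟ a) refl)

∨-left : ∀ {x y} → T x → T (x ∨ y)
∨-left p = Equivalence.from T-∨ (inj₁ p)

surgery-deleting-edge<
  : ∀ {A B deadV deadE k newKind upNew downNew} (a : Fin (nE A)) → T (deadE a) →
    Surgery A B deadV deadE k newKind upNew downNew → nE B < nE A
surgery-deleting-edge< a a-dead s = fewer-alive a a-dead (↔⇒↣ (Surgery.τ s))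

⟶w-removes-edge : ∀ {A B} → A ⟶w B → nE B < nE A
⟶w-removes-edge (rule1 _ _ a _ _ _ _ _ _ _ _ _ s) = surgery-deleting-edge< a (∨-left (==-refl a)) s
⟶w-removes-edge (rule2 _ _ a _ _ _ _ _ _ _ _ _ s) = surgery-deleting-edge< a (∨-left (==-refl a)) s
⟶w-removes-edge (rule3 _ _ a _ _ _ _ _ _ _ s)     = surgery-deleting-edge< a (==-refl a) s
⟶w-removes-edge (rule4 _ _ a _ _ _ _ _ _ _ s)     = surgery-deleting-edge< a (==-refl a) s
⟶w-removes-edge (rule5 _ _ a _ _ _ _ s)           = surgery-deleting-edge< a (==-refl a) s
⟶w-removes-edge (rule6 _ _ a _ _ _ _ _ _ _ _ _ s) = surgery-deleting-edge< a (==-refl a) s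
⟶w-removes-edge (rule7 _ _ a _ _ _ _ _ _ _ _ _ s) = surgery-deleting-edge< a (==-refl a) s

⟶w⁻¹-wellFounded : WellFounded (flip _⟶w_)
⟶w⁻¹-wellFounded =
  Subrelation.wellFounded ⟶w-removes-edge (On.wellFounded nE <-wellFounded)

-- A well-founded relation has no infinite descending sequence: the set of
-- starting points of such sequences is closed under taking the next
-- element, hence empty by well-founded induction.
no-infinite-descent : ∀ {a r} {X : Set a} {_≺_ : Rel X r} → WellFounded _≺_ →
  ¬ Σ (ℕ → X) (InfiniteDescendingSequence _≺_)
no-infinite-descent {a} {r} {X} {_≺_} wf (f , descending) =
  descent∧wf⇒empty starts-descent wf (f 0) (f , refl , descending)
  where
  StartsDescent : X → Set (a ⊔ r)
  StartsDescent x = Σ (ℕ → X) (λ g → InfiniteDescendingSequenceFrom _≺_ g x)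
  starts-descent : ∀ {x} → StartsDescent x →
    Σ X (λ y → y ≺ x × StartsDescent y)
  starts-descent (g , refl , g-desc) =
    g 1 , g-desc 0 , (λ n → g (suc n)) , refl , (λ n → g-desc (suc n))

theorem4p12 : ¬ (Σ (ℕ → Flow) (λ A → ∀ n → A n ⟶w A (suc n)))
theorem4p12 = no-infinite-descent ⟶w⁻¹-wellFounded
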